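{- For any umbra $\gamma$ and every $n\ge0$, $$(x.\beta.\gamma_D)^n\simeq\sum_{k=0}^{n}\binom{n}{k}(k.\gamma)^{n-k}x^k,$$ where $x$ is an indeterminate, $\gamma_D$ is the derivative umbra of $\gamma$, and $k.\gamma$ has g.f. $f(\gamma,t)^k$.
   Context: Classical umbral calculus over a commutative integral domain $R$ whose quotient field has characteristic $0$ (polynomial rings over $R$ allowed as scalars): umbrae are symbols with a linear evaluation $E$ ($E[1]=1$, multiplicative on products of powers of pairwise distinct umbrae); moments $E[\alpha^n]$, g.f. $f(\alpha,t)=\sum_nE[\alpha^n]t^n/n!$; $p\simeq q$ means $E[p]=E[q]$ (coefficientwise in $x$). Bell umbra $\beta$: g.f. $\exp(e^t-1)$. For a scalar $c$ (integer or indeterminate) $c.\alpha$ has g.f. $f(\alpha,t)^c$; for umbrae, $\gamma.\alpha$ has g.f. $f(\gamma,\log f(\alpha,t))$; dot-products associate, so $x.\beta.\alpha$ has g.f. $\exp(x(f(\alpha,t)-1))$ (its moments are $\sum_j x^jB_{n,j}(a_1,a_2,\ldots)$, the partial Bell exponential polynomials in the moments $a_i$ of $\alpha$). The derivative umbra $\alpha_D$ has moments $E[\alpha_D^n]=nE[\alpha^{n-1}]$ ($n\ge1$), i.e. g.f. $1+tf(\alpha,t)$. -}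

module Defs where

open import Level using (Level)
open import Algebra.Bundles using (CommutativeRing)
open import Data.Nat using (ℕ; zero; suc; _∸_; _≡ᵇ_)
open import Data.Nat.Combinatorics using (_C_)
open import Data.Bool using (if_then_else_)
open import Data.Sum using (_⊎_)
open import Relation.Nullary using (¬_)

-- Umbral calculus over a commutative ring R.  An umbra is identified
-- (as far as the evaluation E of its powers is concerned) with its
-- moment sequence  a n = E[α^n]  (with a 0 ≈ 1).
module Umbral {c ℓ : Level} (R : CommutativeRing c ℓ) where
  open CommutativeRing R

  IntegralDomain : Set (c Level.⊔ ℓ)
  IntegralDomain = (¬ (1# ≈ 0#)) × (∀ a b → a * b ≈ 0# → a ≈ 0# ⊎ b ≈ 0#)
    where open import Data.Product using (_×_)

  _·_ : ℕ → Carrier → Carrier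
  zero  · r = 0#
  suc n · r = r + n · r

  CharZero : Set ℓ
  CharZero = ∀ n → ¬ (suc n · 1# ≈ 0#)

  Σ≤ : ℕ → (ℕ → Carrier) → Carrier
  Σ≤ zero    f = f 0
  Σ≤ (suc n) f = Σ≤ n f + f (suc n)

  Moments : Set c
  Moments = ℕ → Carrier

  derivMom : Moments → Moments
  derivMom a zero    = 1#
  derivMom a (suc n) = suc n · a n

  -- Moments of k.γ (g.f. f(γ,t)^k): k-fold binomial convolution
  -- (the product of exponential generating functions).
  dotMom : Moments → ℕ → Moments
  dotMom g zero    n = if n ≡ᵇ 0 then 1# else 0#
  dotMom g (suc k) n = Σ≤ n (λ i → (n C i) · (g i * dotMom g k (n ∸ i)))

  -- The first argument is fuel (always sufficient: n ∸ i ≤ n).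
  bellFuel : ℕ → Moments → ℕ → ℕ → Carrier
  bellFuel zero     a n       j       = 0#
  bellFuel (suc fu) a zero    zero    = 1#
  bellFuel (suc fu) a zero    (suc j) = 0#
  bellFuel (suc fu) a (suc n) zero    = 0#
  bellFuel (suc fu) a (suc n) (suc j) =
    Σ≤ n (λ i → (n C i) · (a (suc i) * bellFuel fu a (n ∸ i) j))

  bell : Moments → ℕ → ℕ → Carrier
  bell a n j = bellFuel (suc n) a n j

  Poly : Set c
  Poly = ℕ → Carrier

  monoX : Carrier → ℕ → Poly
  monoX r k j = if j ≡ᵇ k then r else 0#

  ΣP : ℕ → (ℕ → Poly) → Poly
  ΣP n p j = Σ≤ n (λ k → p k j)

  -- E[(x.β.α)^n] = Σ_j x^j B_{n,j}(a_1,a_2,...)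
  xβMom : Moments → ℕ → Poly
  xβMom a n = ΣP n (λ j → monoX (bell a n j) j)

  _≃_ : Poly → Poly → Set ℓ
  p ≃ q = ∀ j → p j ≈ q j

-- Read moment sequences as exponential generating functions, so that the binomial
-- convolution ⊛ is their product, ∂ is d/dt and mulT is multiplication by t.
-- The derivative umbra γ_D has g.f. 1 + t f(γ,t), and the partial Bell polynomials
-- only see the moments of positive degree, so B_{n,k}(γ_D) is the coefficient of
-- t^n/n! in (t f(γ,t))^k / k! = t^k f(γ,t)^k / k!.  Since t^k acts on coefficients
-- by the falling factorial k! C(n,k), this gives k! B_{n,k}(γ_D) = k! C(n,k) E[(k.γ)^(n-k)],
-- and k! may be cancelled because R is an integral domain of characteristic 0.
module Submission where

open import Defs
open import Level using (Level)
open import Algebra.Bundles using (CommutativeRing)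
open import Data.Nat using (ℕ; _∸_)
open import Data.Nat.Combinatorics using (_C_)

open import Data.Nat.Base as ℕ using (zero; suc; _<_; z≤n; s≤s; _!)
open import Data.Nat.Properties as ℕ using (≤-refl; ≤-trans; m∸n≤m; m≤n⇒m≤1+n; +-∸-assoc; 1≤n!)
open import Data.Nat.Combinatorics using (nCk+nC[k+1]≡[n+1]C[k+1]; k>n⇒nCk≡0; nC1≡n)
open import Data.Bool.Base using (true; false)
open import Data.Empty using (⊥-elim)
open import Data.Product.Base using (_,_)
open import Data.Sum.Base using (inj₁; inj₂)
open import Relation.Binary.PropositionalEquality as ≡ using (_≡_)
import Algebra.Properties.CommutativeSemigroup as CommutativeSemigroupProperties
import Algebra.Properties.CommutativeMonoid.Mult as CommutativeMonoidMult
import Algebra.Properties.Semiring.Mult as SemiringMult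
import Algebra.Properties.Ring as RingProperties
import Algebra.Properties.Group as GroupProperties

[k+1]*[n+1]C[k+1]≡[n+1]*nCk : ∀ n k → suc k ℕ.* (suc n C suc k) ≡ suc n ℕ.* (n C k)
[k+1]*[n+1]C[k+1]≡[n+1]*nCk zero    zero    = ≡.refl
[k+1]*[n+1]C[k+1]≡[n+1]*nCk zero    (suc k)
  rewrite k>n⇒nCk≡0 {1} {suc (suc k)} (s≤s (s≤s z≤n)) | k>n⇒nCk≡0 {0} {suc k} (s≤s z≤n)
  = ℕ.*-zeroʳ k
[k+1]*[n+1]C[k+1]≡[n+1]*nCk (suc n) zero
  rewrite nC1≡n (suc (suc n)) = ℕ.*-comm 1 (suc (suc n))
[k+1]*[n+1]C[k+1]≡[n+1]*nCk (suc n) (suc k) = begin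
    suc (suc k) ℕ.* (suc (suc n) C suc (suc k))
  ≡⟨ ≡.cong (suc (suc k) ℕ.*_) (≡.sym (nCk+nC[k+1]≡[n+1]C[k+1] (suc n) (suc k))) ⟩
    suc (suc k) ℕ.* (x ℕ.+ y)
  ≡⟨ ℕ.*-distribˡ-+ (suc (suc k)) x y ⟩
    (x ℕ.+ suc k ℕ.* x) ℕ.+ suc (suc k) ℕ.* y
  ≡⟨ ≡.cong₂ (λ a b → (x ℕ.+ a) ℕ.+ b) ([k+1]*[n+1]C[k+1]≡[n+1]*nCk n k)
                                        ([k+1]*[n+1]C[k+1]≡[n+1]*nCk n (suc k)) ⟩
    (x ℕ.+ suc n ℕ.* (n C k)) ℕ.+ suc n ℕ.* (n C suc k)
  ≡⟨ ℕ.+-assoc x _ _ ⟩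
    x ℕ.+ (suc n ℕ.* (n C k) ℕ.+ suc n ℕ.* (n C suc k))
  ≡⟨ ≡.cong (x ℕ.+_) (≡.sym (ℕ.*-distribˡ-+ (suc n) (n C k) (n C suc k))) ⟩
    x ℕ.+ suc n ℕ.* (n C k ℕ.+ n C suc k)
  ≡⟨ ≡.cong (λ z → x ℕ.+ suc n ℕ.* z) (nCk+nC[k+1]≡[n+1]C[k+1] n k) ⟩
    suc (suc n) ℕ.* x
  ∎
  where
  open ≡.≡-Reasoning
  x = suc n C suc k
  y = suc n C suc (suc k)

[n+1]*[k!*nCk]≡[k+1]!*[n+1]C[k+1] :
  ∀ n k → suc n ℕ.* (k ! ℕ.* (n C k)) ≡ suc k ! ℕ.* (suc n C suc k)
[n+1]*[k!*nCk]≡[k+1]!*[n+1]C[k+1] n k = begin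
    suc n ℕ.* (k ! ℕ.* (n C k))        ≡⟨ x∙yz≈y∙xz (suc n) (k !) (n C k) ⟩
    k ! ℕ.* (suc n ℕ.* (n C k))        ≡⟨ ≡.cong (k ! ℕ.*_) (≡.sym ([k+1]*[n+1]C[k+1]≡[n+1]*nCk n k)) ⟩
    k ! ℕ.* (suc k ℕ.* (suc n C suc k)) ≡⟨ ≡.sym (xy∙z≈y∙xz (suc k) (k !) (suc n C suc k)) ⟩
    suc k ! ℕ.* (suc n C suc k)        ∎
  where
  open ≡.≡-Reasoning
  open CommutativeSemigroupProperties ℕ.*-commutativeSemigroup using (x∙yz≈y∙xz; xy∙z≈y∙xz)

module ExponentialGeneratingFunctions {c ℓ : Level} (R : CommutativeRing c ℓ) where
  open CommutativeRing R
  open Umbral R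
  open import Relation.Binary.Reasoning.Setoid setoid
  open CommutativeSemigroupProperties +-commutativeSemigroup using (interchange)
    renaming (x∙yz≈y∙xz to +-lcomm)
  open CommutativeSemigroupProperties *-commutativeSemigroup using ()
    renaming (x∙yz≈y∙xz to *-lcomm)
  open CommutativeMonoidMult +-commutativeMonoid using (×-distrib-+)
  open SemiringMult semiring using (_×_; ×-congʳ; ×-congˡ; ×-homo-+; ×-assocˡ; ×-assoc-*)
  open RingProperties ring using (x[y-z]≈xy-xz)
  open GroupProperties +-group using (x∙y⁻¹≈ε⇒x≈y; x≈y⇒x∙y⁻¹≈ε)

  ·≡× : ∀ n r → n · r ≡ n × r
  ·≡× zero    r = ≡.refl
  ·≡× (suc n) r = ≡.cong (r +_) (·≡× n r)

  ·-congʳ : ∀ n {x y} → x ≈ y → n · x ≈ n · y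
  ·-congʳ n {x} {y} rewrite ·≡× n x | ·≡× n y = ×-congʳ n

  ·-zeroʳ : ∀ n → n · 0# ≈ 0#
  ·-zeroʳ n rewrite ·≡× n 0# = trans (×-assocˡ 0# n 0) (×-congˡ (ℕ.*-zeroʳ n))

  ·-distribˡ-+ : ∀ n x y → n · (x + y) ≈ n · x + n · y
  ·-distribˡ-+ n x y rewrite ·≡× n (x + y) | ·≡× n x | ·≡× n y = ×-distrib-+ x y n

  ·-homo-+ : ∀ m n x → (m ℕ.+ n) · x ≈ m · x + n · x
  ·-homo-+ m n x rewrite ·≡× (m ℕ.+ n) x | ·≡× m x | ·≡× n x = ×-homo-+ x m n

  ·-assoc : ∀ m n x → m · (n · x) ≈ (m ℕ.* n) · x
  ·-assoc m n x rewrite ·≡× n x | ·≡× m (n × x) | ·≡× (m ℕ.* n) x = ×-assocˡ x m n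

  ·-assoc-* : ∀ n x y → (n · x) * y ≈ n · (x * y)
  ·-assoc-* n x y rewrite ·≡× n x | ·≡× n (x * y) = ×-assoc-* n x y

  ·-comm : ∀ m n x → m · (n · x) ≈ n · (m · x)
  ·-comm m n x = begin
    m · (n · x)      ≈⟨ ·-assoc m n x ⟩
    (m ℕ.* n) · x    ≡⟨ ≡.cong (_· x) (ℕ.*-comm m n) ⟩
    (n ℕ.* m) · x    ≈⟨ ·-assoc n m x ⟨
    n · (m · x)      ∎

  ·-comm-* : ∀ n x y → n · (x * y) ≈ x * (n · y)
  ·-comm-* n x y = begin
    n · (x * y)   ≈⟨ ·-congʳ n (*-comm x y) ⟩
    n · (y * x)   ≈⟨ ·-assoc-* n y x ⟨
    (n · y) * x   ≈⟨ *-comm _ x ⟩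
    x * (n · y)   ∎

  ·-cancelˡ : IntegralDomain → CharZero → ∀ m → 0 < m → ∀ {x y} → m · x ≈ m · y → x ≈ y
  ·-cancelˡ (_ , noZeroDivisors) char0 (suc m) _ {x} {y} mx≈my
    with noZeroDivisors (suc m · 1#) (x - y) [m·1][x-y]≈0
    where
    m·≈m·1* : ∀ z → suc m · z ≈ (suc m · 1#) * z
    m·≈m·1* z = trans (·-congʳ (suc m) (sym (*-identityˡ z))) (sym (·-assoc-* (suc m) 1# z))
    [m·1][x-y]≈0 : (suc m · 1#) * (x - y) ≈ 0#
    [m·1][x-y]≈0 = begin
      (suc m · 1#) * (x - y)                    ≈⟨ x[y-z]≈xy-xz _ x y ⟩
      (suc m · 1#) * x - (suc m · 1#) * y        ≈⟨ +-cong (m·≈m·1* x) (-‿cong (m·≈m·1* y)) ⟨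
      suc m · x - suc m · y                      ≈⟨ x≈y⇒x∙y⁻¹≈ε mx≈my ⟩
      0#                                         ∎
  ... | inj₁ m·1≈0 = ⊥-elim (char0 m m·1≈0)
  ... | inj₂ x-y≈0 = x∙y⁻¹≈ε⇒x≈y x y x-y≈0

  Σ≤-cong : ∀ n {f g : ℕ → Carrier} → (∀ i → i ℕ.≤ n → f i ≈ g i) → Σ≤ n f ≈ Σ≤ n g
  Σ≤-cong zero    f≈g = f≈g 0 z≤n
  Σ≤-cong (suc n) f≈g = +-cong (Σ≤-cong n (λ i i≤n → f≈g i (m≤n⇒m≤1+n i≤n))) (f≈g (suc n) ≤-refl)

  Σ≤-distrib-+ : ∀ n (f g : ℕ → Carrier) → Σ≤ n (λ i → f i + g i) ≈ Σ≤ n f + Σ≤ n g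
  Σ≤-distrib-+ zero    f g = refl
  Σ≤-distrib-+ (suc n) f g = trans (+-congʳ (Σ≤-distrib-+ n f g)) (interchange _ _ _ _)

  ·-distrib-Σ≤ : ∀ k n (f : ℕ → Carrier) → k · Σ≤ n f ≈ Σ≤ n (λ i → k · f i)
  ·-distrib-Σ≤ k zero    f = refl
  ·-distrib-Σ≤ k (suc n) f = trans (·-distribˡ-+ k _ _) (+-congʳ (·-distrib-Σ≤ k n f))

  Σ≤-zero : ∀ n (f : ℕ → Carrier) → (∀ i → f i ≈ 0#) → Σ≤ n f ≈ 0#
  Σ≤-zero zero    f f≈0 = f≈0 0
  Σ≤-zero (suc n) f f≈0 = trans (+-cong (Σ≤-zero n f f≈0) (f≈0 (suc n))) (+-identityʳ 0#)

  Σ≤-unfoldˡ : ∀ n (f : ℕ → Carrier) → Σ≤ (suc n) f ≈ f 0 + Σ≤ n (λ i → f (suc i))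
  Σ≤-unfoldˡ zero    f = refl
  Σ≤-unfoldˡ (suc n) f = trans (+-congʳ (Σ≤-unfoldˡ n f)) (+-assoc _ _ _)

  infixl 30 _⊛_
  infixl 25 _⊕_
  infixr 35 _⊙_

  _⊛_ : Moments → Moments → Moments
  (u ⊛ v) n = Σ≤ n (λ i → (n C i) · (u i * v (n ∸ i)))

  _⊕_ : Moments → Moments → Moments
  (u ⊕ v) n = u n + v n

  _⊙_ : ℕ → Moments → Moments
  (k ⊙ u) n = k · u n

  ∂ : Moments → Moments
  ∂ u n = u (suc n)

  mulT : Moments → Moments
  mulT u zero    = 0#
  mulT u (suc n) = suc n · u n

  mulT^ : ℕ → Moments → Moments
  mulT^ zero    u = u
  mulT^ (suc j) u = mulT (mulT^ j u)

  ⊛-congʳ : ∀ u {v v′} → v ≃ v′ → u ⊛ v ≃ u ⊛ v′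
  ⊛-congʳ u v≃v′ n = Σ≤-cong n (λ i _ → ·-congʳ (n C i) (*-congˡ (v≃v′ (n ∸ i))))

  ⊛-congˡ : ∀ {u u′} v → u ≃ u′ → u ⊛ v ≃ u′ ⊛ v
  ⊛-congˡ v u≃u′ n = Σ≤-cong n (λ i _ → ·-congʳ (n C i) (*-congʳ (u≃u′ i)))

  ⊛-distribˡ-⊕ : ∀ u v w → u ⊛ (v ⊕ w) ≃ u ⊛ v ⊕ u ⊛ w
  ⊛-distribˡ-⊕ u v w n = trans
    (Σ≤-cong n (λ i _ → trans (·-congʳ (n C i) (distribˡ _ _ _)) (·-distribˡ-+ (n C i) _ _)))
    (Σ≤-distrib-+ n _ _)

  ⊛-distribʳ-⊕ : ∀ u v w → (u ⊕ v) ⊛ w ≃ u ⊛ w ⊕ v ⊛ w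
  ⊛-distribʳ-⊕ u v w n = trans
    (Σ≤-cong n (λ i _ → trans (·-congʳ (n C i) (distribʳ _ _ _)) (·-distribˡ-+ (n C i) _ _)))
    (Σ≤-distrib-+ n _ _)

  ⊛-zeroʳ : ∀ u → u ⊛ (λ _ → 0#) ≃ (λ _ → 0#)
  ⊛-zeroʳ u n = Σ≤-zero n _ (λ i → trans (·-congʳ (n C i) (zeroʳ (u i))) (·-zeroʳ (n C i)))

  ·-⊛ : ∀ k u v n → k · (u ⊛ v) n ≈ (u ⊛ k ⊙ v) n
  ·-⊛ k u v n = trans (·-distrib-Σ≤ k n _) (Σ≤-cong n (λ i _ →
    trans (·-comm k (n C i) _) (·-congʳ (n C i) (·-comm-* k (u i) _))))

  ⊛-at-0 : ∀ u v → (u ⊛ v) 0 ≈ u 0 * v 0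
  ⊛-at-0 u v = +-identityʳ _

  ∂-⊛ : ∀ u v → ∂ (u ⊛ v) ≃ ∂ u ⊛ v ⊕ u ⊛ ∂ v
  ∂-⊛ u v n = begin
      Σ≤ (suc n) f
    ≈⟨ Σ≤-unfoldˡ n f ⟩
      f 0 + Σ≤ n (λ i → f (suc i))
    ≈⟨ +-congˡ (trans (Σ≤-cong n (λ i _ → pascal i)) (Σ≤-distrib-+ n _ _)) ⟩
      f 0 + ((∂ u ⊛ v) n + Σ≤ n (λ i → g (suc i)))
    ≈⟨ +-lcomm _ _ _ ⟩
      (∂ u ⊛ v) n + (f 0 + Σ≤ n (λ i → g (suc i)))
    ≈⟨ +-congˡ (Σ≤-unfoldˡ n g) ⟨
      (∂ u ⊛ v) n + Σ≤ (suc n) g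
    ≈⟨ +-congˡ (trans (+-congˡ g-top≈0) (+-identityʳ _)) ⟩
      (∂ u ⊛ v) n + Σ≤ n g
    ≈⟨ +-congˡ (Σ≤-cong n (λ i i≤n →
         reflexive (≡.cong (λ m → (n C i) · (u i * v m)) (+-∸-assoc 1 i≤n)))) ⟩
      (∂ u ⊛ v) n + (u ⊛ ∂ v) n
    ∎
    where
    f g : ℕ → Carrier
    f i = (suc n C i) · (u i * v (suc n ∸ i))
    g i = (n C i) · (u i * v (suc n ∸ i))
    pascal : ∀ i → f (suc i) ≈ (n C i) · (u (suc i) * v (n ∸ i)) + g (suc i)
    pascal i = trans (reflexive (≡.cong (_· (u (suc i) * v (n ∸ i))) (≡.sym (nCk+nC[k+1]≡[n+1]C[k+1] n i))))
                     (·-homo-+ (n C i) (n C suc i) _)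
    g-top≈0 : g (suc n) ≈ 0#
    g-top≈0 = reflexive (≡.cong (_· (u (suc n) * v (n ∸ n))) (k>n⇒nCk≡0 {n} {suc n} ≤-refl))

  ⊛-comm : ∀ u v → u ⊛ v ≃ v ⊛ u
  ⊛-comm u v zero    = trans (⊛-at-0 u v) (trans (*-comm _ _) (sym (⊛-at-0 v u)))
  ⊛-comm u v (suc n) = begin
    (u ⊛ v) (suc n)                  ≈⟨ ∂-⊛ u v n ⟩
    (∂ u ⊛ v) n + (u ⊛ ∂ v) n        ≈⟨ +-cong (⊛-comm (∂ u) v n) (⊛-comm u (∂ v) n) ⟩
    (v ⊛ ∂ u) n + (∂ v ⊛ u) n        ≈⟨ +-comm _ _ ⟩
    (∂ v ⊛ u) n + (v ⊛ ∂ u) n        ≈⟨ ∂-⊛ v u n ⟨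
    (v ⊛ u) (suc n)                  ∎

  ⊛-lcomm : ∀ u v w → u ⊛ (v ⊛ w) ≃ v ⊛ (u ⊛ w)
  ⊛-lcomm u v w zero = begin
    (u ⊛ (v ⊛ w)) 0    ≈⟨ trans (⊛-at-0 u (v ⊛ w)) (*-congˡ (⊛-at-0 v w)) ⟩
    u 0 * (v 0 * w 0)  ≈⟨ *-lcomm _ _ _ ⟩
    v 0 * (u 0 * w 0)  ≈⟨ trans (⊛-at-0 v (u ⊛ w)) (*-congˡ (⊛-at-0 u w)) ⟨
    (v ⊛ (u ⊛ w)) 0    ∎
  ⊛-lcomm u v w (suc n) = begin
      (u ⊛ (v ⊛ w)) (suc n)
    ≈⟨ ∂-⊛ u (v ⊛ w) n ⟩
      (∂ u ⊛ (v ⊛ w)) n + (u ⊛ ∂ (v ⊛ w)) n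
    ≈⟨ +-congˡ (expand u v w) ⟩
      (∂ u ⊛ (v ⊛ w)) n + ((u ⊛ (∂ v ⊛ w)) n + (u ⊛ (v ⊛ ∂ w)) n)
    ≈⟨ +-cong (⊛-lcomm (∂ u) v w n) (+-cong (⊛-lcomm u (∂ v) w n) (⊛-lcomm u v (∂ w) n)) ⟩
      (v ⊛ (∂ u ⊛ w)) n + ((∂ v ⊛ (u ⊛ w)) n + (v ⊛ (u ⊛ ∂ w)) n)
    ≈⟨ +-lcomm _ _ _ ⟩
      (∂ v ⊛ (u ⊛ w)) n + ((v ⊛ (∂ u ⊛ w)) n + (v ⊛ (u ⊛ ∂ w)) n)
    ≈⟨ +-congˡ (expand v u w) ⟨
      (∂ v ⊛ (u ⊛ w)) n + (v ⊛ ∂ (u ⊛ w)) n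
    ≈⟨ ∂-⊛ v (u ⊛ w) n ⟨
      (v ⊛ (u ⊛ w)) (suc n)
    ∎
    where
    expand : ∀ a b c → (a ⊛ ∂ (b ⊛ c)) n ≈ (a ⊛ (∂ b ⊛ c)) n + (a ⊛ (b ⊛ ∂ c)) n
    expand a b c = trans (⊛-congʳ a (∂-⊛ b c) n) (⊛-distribˡ-⊕ a (∂ b ⊛ c) (b ⊛ ∂ c) n)

  mulT-cong : ∀ {u v} → u ≃ v → mulT u ≃ mulT v
  mulT-cong u≃v zero    = refl
  mulT-cong u≃v (suc n) = ·-congʳ (suc n) (u≃v n)

  mulT-⊕ : ∀ u v → mulT (u ⊕ v) ≃ mulT u ⊕ mulT v
  mulT-⊕ u v zero    = sym (+-identityʳ 0#)
  mulT-⊕ u v (suc n) = ·-distribˡ-+ (suc n) _ _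

  ∂-mulT : ∀ u → ∂ (mulT u) ≃ u ⊕ mulT (∂ u)
  ∂-mulT u zero    = refl
  ∂-mulT u (suc n) = refl

  mulT-⊛ : ∀ u v → mulT (u ⊛ v) ≃ mulT u ⊛ v
  mulT-⊛ u v zero    = sym (trans (⊛-at-0 (mulT u) v) (zeroˡ (v 0)))
  mulT-⊛ u v (suc n) = begin
      mulT (u ⊛ v) (suc n)
    ≈⟨ ∂-mulT (u ⊛ v) n ⟩
      (u ⊛ v) n + mulT (∂ (u ⊛ v)) n
    ≈⟨ +-congˡ (trans (mulT-cong (∂-⊛ u v) n) (mulT-⊕ _ _ n)) ⟩
      (u ⊛ v) n + (mulT (∂ u ⊛ v) n + mulT (u ⊛ ∂ v) n)
    ≈⟨ +-congˡ (+-cong (mulT-⊛ (∂ u) v n) (mulT-⊛ u (∂ v) n)) ⟩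
      (u ⊛ v) n + ((mulT (∂ u) ⊛ v) n + (mulT u ⊛ ∂ v) n)
    ≈⟨ +-assoc _ _ _ ⟨
      ((u ⊛ v) n + (mulT (∂ u) ⊛ v) n) + (mulT u ⊛ ∂ v) n
    ≈⟨ +-congʳ (sym (trans (⊛-congˡ v (∂-mulT u) n) (⊛-distribʳ-⊕ u (mulT (∂ u)) v n))) ⟩
      (∂ (mulT u) ⊛ v) n + (mulT u ⊛ ∂ v) n
    ≈⟨ ∂-⊛ (mulT u) v n ⟨
      (mulT u ⊛ v) (suc n)
    ∎

  ⊛-mulT : ∀ u v → u ⊛ mulT v ≃ mulT (u ⊛ v)
  ⊛-mulT u v n = begin
    (u ⊛ mulT v) n     ≈⟨ ⊛-comm u (mulT v) n ⟩
    (mulT v ⊛ u) n     ≈⟨ mulT-⊛ v u n ⟨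
    mulT (v ⊛ u) n     ≈⟨ mulT-cong (⊛-comm v u) n ⟩
    mulT (u ⊛ v) n     ∎

  ⊛-mulT^ : ∀ j u v → u ⊛ mulT^ j v ≃ mulT^ j (u ⊛ v)
  ⊛-mulT^ zero    u v = λ _ → refl
  ⊛-mulT^ (suc j) u v n =
    trans (⊛-mulT u (mulT^ j v) n) (mulT-cong (⊛-mulT^ j u v) n)

  mulT^-closed : ∀ j n u → mulT^ j u n ≈ (j ! ℕ.* (n C j)) · u (n ∸ j)
  mulT^-closed zero    n       u = sym (+-identityʳ _)
  mulT^-closed (suc j) zero    u = sym (reflexive (≡.cong (_· u 0) (ℕ.*-zeroʳ (suc j !))))
  mulT^-closed (suc j) (suc n) u = begin
    suc n · mulT^ j u n                              ≈⟨ ·-congʳ (suc n) (mulT^-closed j n u) ⟩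
    suc n · ((j ! ℕ.* (n C j)) · u (n ∸ j))          ≈⟨ ·-assoc (suc n) (j ! ℕ.* (n C j)) (u (n ∸ j)) ⟩
    (suc n ℕ.* (j ! ℕ.* (n C j))) · u (n ∸ j)        ≡⟨ ≡.cong (_· u (n ∸ j)) ([n+1]*[k!*nCk]≡[k+1]!*[n+1]C[k+1] n j) ⟩
    (suc j ! ℕ.* (suc n C suc j)) · u (n ∸ j)        ∎

  dotMom-mulT : ∀ u k → dotMom (mulT u) k ≃ mulT^ k (dotMom u k)
  dotMom-mulT u zero    = λ _ → refl
  dotMom-mulT u (suc k) n = begin
    (mulT u ⊛ dotMom (mulT u) k) n         ≈⟨ ⊛-congʳ (mulT u) (dotMom-mulT u k) n ⟩
    (mulT u ⊛ mulT^ k (dotMom u k)) n      ≈⟨ mulT-⊛ u (mulT^ k (dotMom u k)) n ⟨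
    mulT (u ⊛ mulT^ k (dotMom u k)) n      ≈⟨ mulT-cong (⊛-mulT^ k u (dotMom u k)) n ⟩
    mulT^ (suc k) (dotMom u (suc k)) n     ∎

  ∂-dotMom : ∀ g k → ∂ (dotMom g (suc k)) ≃ suc k ⊙ (∂ g ⊛ dotMom g k)
  ∂-dotMom g zero    n = trans (∂-⊛ g (dotMom g 0) n) (+-congˡ (⊛-zeroʳ g n))
  ∂-dotMom g (suc k) n = begin
      ∂ (dotMom g (suc (suc k))) n
    ≈⟨ ∂-⊛ g (dotMom g (suc k)) n ⟩
      (∂ g ⊛ dotMom g (suc k)) n + (g ⊛ ∂ (dotMom g (suc k))) n
    ≈⟨ +-congˡ (⊛-congʳ g (∂-dotMom g k) n) ⟩
      (∂ g ⊛ dotMom g (suc k)) n + (g ⊛ suc k ⊙ (∂ g ⊛ dotMom g k)) n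
    ≈⟨ +-congˡ (·-⊛ (suc k) g (∂ g ⊛ dotMom g k) n) ⟨
      (∂ g ⊛ dotMom g (suc k)) n + suc k · (g ⊛ (∂ g ⊛ dotMom g k)) n
    ≈⟨ +-congˡ (·-congʳ (suc k) (⊛-lcomm g (∂ g) (dotMom g k) n)) ⟩
      (suc (suc k) ⊙ (∂ g ⊛ dotMom g (suc k))) n
    ∎

  -- B_{n,j}(a_1,a_2,…) as a function of b i = a_{i+1}, without fuel.
  bellRec : Moments → ℕ → Moments
  bellRec b zero    zero    = 1#
  bellRec b zero    (suc n) = 0#
  bellRec b (suc j) zero    = 0#
  bellRec b (suc j) (suc n) = (b ⊛ bellRec b j) n

  bellFuel≈bellRec : ∀ fuel n → n < fuel → ∀ a j → bellFuel fuel a n j ≈ bellRec (∂ a) j n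
  bellFuel≈bellRec (suc fuel) zero    _           a zero    = refl
  bellFuel≈bellRec (suc fuel) zero    _           a (suc j) = refl
  bellFuel≈bellRec (suc fuel) (suc n) _           a zero    = refl
  bellFuel≈bellRec (suc fuel) (suc n) (s≤s n<fuel) a (suc j) = Σ≤-cong n (λ i _ →
    ·-congʳ (n C i) (*-congˡ (bellFuel≈bellRec fuel (n ∸ i) (≤-trans (s≤s (m∸n≤m n i)) n<fuel) a j)))

  bell≈bellRec : ∀ a n j → bell a n j ≈ bellRec (∂ a) j n
  bell≈bellRec a n j = bellFuel≈bellRec (suc n) n ≤-refl a j

  k!·bellRec≈dotMom : ∀ g → g 0 ≈ 0# → ∀ k n → (k !) · bellRec (∂ g) k n ≈ dotMom g k n
  k!·bellRec≈dotMom g g0≈0 zero    zero    = +-identityʳ 1#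
  k!·bellRec≈dotMom g g0≈0 zero    (suc n) = +-identityʳ 0#
  k!·bellRec≈dotMom g g0≈0 (suc k) zero    = begin
    (suc k !) · 0#     ≈⟨ ·-zeroʳ (suc k !) ⟩
    0#                 ≈⟨ zeroˡ _ ⟨
    0# * dotMom g k 0  ≈⟨ *-congʳ g0≈0 ⟨
    g 0 * dotMom g k 0 ≈⟨ ⊛-at-0 g (dotMom g k) ⟨
    dotMom g (suc k) 0 ∎
  k!·bellRec≈dotMom g g0≈0 (suc k) (suc n) = begin
    (suc k ℕ.* k !) · (∂ g ⊛ bellRec (∂ g) k) n ≈⟨ ·-assoc (suc k) (k !) _ ⟨
    suc k · ((k !) · (∂ g ⊛ bellRec (∂ g) k) n) ≈⟨ ·-congʳ (suc k) (·-⊛ (k !) (∂ g) (bellRec (∂ g) k) n) ⟩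
    suc k · (∂ g ⊛ (k !) ⊙ bellRec (∂ g) k) n   ≈⟨ ·-congʳ (suc k) (⊛-congʳ (∂ g) (k!·bellRec≈dotMom g g0≈0 k) n) ⟩
    suc k · (∂ g ⊛ dotMom g k) n                ≈⟨ ∂-dotMom g k n ⟨
    dotMom g (suc k) (suc n)                    ∎

  -- ∂ (derivMom γ) and ∂ (mulT γ) coincide definitionally.
  bell-derivMom : IntegralDomain → CharZero →
                  ∀ γ n k → bell (derivMom γ) n k ≈ (n C k) · dotMom γ k (n ∸ k)
  bell-derivMom domain char0 γ n k = ·-cancelˡ domain char0 (k !) (1≤n! k) (begin
    (k !) · bell (derivMom γ) n k              ≈⟨ ·-congʳ (k !) (bell≈bellRec (derivMom γ) n k) ⟩
    (k !) · bellRec (∂ (mulT γ)) k n           ≈⟨ k!·bellRec≈dotMom (mulT γ) refl k n ⟩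
    dotMom (mulT γ) k n                        ≈⟨ dotMom-mulT γ k n ⟩
    mulT^ k (dotMom γ k) n                     ≈⟨ mulT^-closed k n (dotMom γ k) ⟩
    (k ! ℕ.* (n C k)) · dotMom γ k (n ∸ k)     ≈⟨ ·-assoc (k !) (n C k) _ ⟨
    (k !) · ((n C k) · dotMom γ k (n ∸ k))     ∎)

  monoX-congˡ : ∀ {r s} → r ≈ s → ∀ k → monoX r k ≃ monoX s k
  monoX-congˡ r≈s k j with j ℕ.≡ᵇ k
  ... | true  = r≈s
  ... | false = refl

  ΣP-cong : ∀ n {p q : ℕ → Poly} → (∀ k → p k ≃ q k) → ΣP n p ≃ ΣP n q
  ΣP-cong n p≃q j = Σ≤-cong n (λ k _ → p≃q k j)

corollary7p2 : ∀ {c ℓ : Level} (R : CommutativeRing c ℓ) →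
    let open CommutativeRing R in
    let open Umbral R in
    IntegralDomain → CharZero →
    (γ : Moments) → γ 0 ≈ 1# →
    (n : ℕ) →
    xβMom (derivMom γ) n ≃ ΣP n (λ k → monoX ((n C k) · dotMom γ k (n ∸ k)) k)
corollary7p2 R domain char0 γ _ n =
  ΣP-cong n (λ k → monoX-congˡ (bell-derivMom domain char0 γ n k) k)
  where open ExponentialGeneratingFunctions R
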